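{- (1) Let $g:\mathbb{N}^p\to\mathbb{N}$, $h:\mathbb{Z}\times\mathbb{N}^{p+1}\to\mathbb{Z}$ and $f=\mathrm{ODE}(g,h)$. If $g$ and $\tilde h$ are primitive recursive then $\tilde f$ is primitive recursive; if moreover $f$ takes values in $\mathbb{N}$ (i.e. $f:\mathbb{N}^{p+1}\to\mathbb{N}$), then $f$ is primitive recursive. (2) Let $g:\mathbb{N}^p\to\mathbb{N}$ and $h:\mathbb{N}^{p+2}\to\mathbb{N}$. Then the function $f=\mathrm{REC}(g,h)$ defined by primitive recursion coincides with $\mathrm{ODE}(g,\bar h)$, where $\bar h:\mathbb{N}^{p+2}\to\mathbb{Z}$ is $\bar h(z,x,\mathbf y)=h(z,x,\mathbf y)-z$.
   Context: Discrete ODE scheme: $\mathrm{ODE}(g,h)$ is the unique $f:\mathbb{N}^{p+1}\to\mathbb{Z}$ with $f(0,\mathbf y)=g(\mathbf y)$ and $f(x+1,\mathbf y)-f(x,\mathbf y)=h(f(x,\mathbf y),x,\mathbf y)$. Primitive recursion: $\mathrm{REC}(g,h)$ is the $f:\mathbb{N}^{p+1}\to\mathbb{N}$ with $f(0,\mathbf y)=g(\mathbf y)$ and $f(x+1,\mathbf y)=h(f(x,\mathbf y),x,\mathbf y)$. Integers are represented by $\tilde{\mathbb{Z}}=\{0,1\}\times\mathbb{N}$, the pair $(s,n)$ encoding $(-1)^sn$; for a function $f$ with arguments/values in $\mathbb{Z}$, $\tilde f$ denotes the corresponding function on $\tilde{\mathbb{Z}}$ (natural-number arguments unchanged), and primitive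 recursiveness of $\tilde f$ refers to functions over natural numbers via this encoding. -}

module Defs where

open import Data.Nat using (ℕ; zero; suc)
open import Data.Fin using (Fin)
open import Data.Vec using (Vec; []; _∷_; lookup)
open import Data.Integer using (ℤ; +_; -[1+_]; _+_; _-_; ∣_∣)
open import Data.Product using (Σ; _×_)
open import Relation.Binary.PropositionalEquality using (_≡_)

data PR : ℕ → Set where
  Z    : ∀ {n} → PR n
  S    : PR 1
  P    : ∀ {n} → Fin n → PR n
  C    : ∀ {m n} → PR m → Vec (PR n) m → PR n
  R    : ∀ {n} → PR n → PR (suc (suc n)) → PR (suc n)

mutual
  eval : ∀ {n} → PR n → Vec ℕ n → ℕ
  eval Z v = 0
  eval S (x ∷ []) = suc x
  eval (P i) v = lookup v i
  eval (C f gs) v = eval f (evalAll gs v)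
  eval (R g h) (x ∷ v) = evalRec g h x v

  evalAll : ∀ {m n} → Vec (PR n) m → Vec ℕ n → Vec ℕ m
  evalAll [] v = []
  evalAll (g ∷ gs) v = eval g v ∷ evalAll gs v

  evalRec : ∀ {n} → PR n → PR (suc (suc n)) → ℕ → Vec ℕ n → ℕ
  evalRec g h zero v = eval g v
  evalRec g h (suc x) v = eval h (evalRec g h x v ∷ x ∷ v)

IsPR : (n : ℕ) → (Vec ℕ n → ℕ) → Set
IsPR n f = Σ (PR n) (λ c → ∀ v → eval c v ≡ f v)

-- Sign bit of the (canonical) encoding of an integer in {0,1} × ℕ:
-- (-1)^s n with s = 0 for z ≥ 0 and s = 1 for z < 0; magnitude is ∣ z ∣.
signBit : ℤ → ℕ
signBit (+ n) = 0
signBit -[1+ n ] = 1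

ODE : ∀ {p} → (Vec ℕ p → ℕ) → (ℤ → ℕ → Vec ℕ p → ℤ) → ℕ → Vec ℕ p → ℤ
ODE g h zero y = + g y
ODE g h (suc x) y = ODE g h x y + h (ODE g h x y) x y

REC : ∀ {p} → (Vec ℕ p → ℕ) → (ℕ → ℕ → Vec ℕ p → ℕ) → ℕ → Vec ℕ p → ℕ
REC g h zero y = g y
REC g h (suc x) y = h (REC g h x y) x y

-- h̃ : {0,1}×ℕ × ℕ × ℕ^p → {0,1}×ℕ is primitive recursive: its sign and
-- magnitude components are computed by PR functions of arity p+3, on the
-- (canonical) encodings (signBit z , ∣ z ∣) of the integer argument z.
IsPRTilde : ∀ p → (ℤ → ℕ → Vec ℕ p → ℤ) → Set
IsPRTilde p h =
  Σ (PR (suc (suc (suc p)))) (λ cs →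
    ∀ z x y → eval cs (signBit z ∷ ∣ z ∣ ∷ x ∷ y) ≡ signBit (h z x y))
  × Σ (PR (suc (suc (suc p)))) (λ cm →
    ∀ z x y → eval cm (signBit z ∷ ∣ z ∣ ∷ x ∷ y) ≡ ∣ h z x y ∣)

{-# OPTIONS --safe #-}
-- Encode an integer z by the natural number signBit z + 2 ∣ z ∣, packing the pair
-- (signBit z , ∣ z ∣) into one number. Addition is computable on encodings by ℕ-arithmetic:
-- z + w = (P z + P w) ⊖ (N z + N w) for the positive and negative parts P, N, and a ⊖ b has
-- sign bit sg (b ∸ a) and magnitude (a ∸ b) + (b ∸ a). So the encoded solution of the ODE obeys
-- an ordinary primitive recursion, whose step decodes the previous value by parity and halving,
-- applies h̃ and re-encodes the sum; sign and magnitude of f are the parity and half of it.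
-- Part (2) is the telescoping identity r + (h r - r) = h r.
module Submission where

open import Defs
open import Data.Nat as ℕ using (ℕ; zero; suc; pred; _∸_; _≤?_)
import Data.Nat.Properties as ℕ
open import Data.Integer using (ℤ; +_; -[1+_]; -_; _+_; _-_; _⊖_; ∣_∣; 0ℤ; _≤_)
open import Data.Integer.Properties using (⊖-≥; ⊖-<; pos-+; [+m]-[+n]≡m⊖n)
open import Data.Integer.Tactic.RingSolver using (solve-∀)
open import Data.Fin using (Fin)
open import Data.Vec using (Vec; []; _∷_; head; tail; lookup; tabulate)
open import Data.Vec.Properties using (tabulate∘lookup)
open import Data.Product using (Σ; _×_; _,_)
open import Function using (_∘_; const; flip)
open import Relation.Nullary using (yes; no)
open import Relation.Binary.PropositionalEquality
  using (_≡_; refl; sym; trans; cong; cong₂; _≗_; module ≡-Reasoning)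

private
  variable
    m n : ℕ
    f g a b : Vec ℕ n → ℕ

IsPRs : (n m : ℕ) → (Vec ℕ n → Vec ℕ m) → Set
IsPRs n m F = Σ (Vec (PR n) m) (λ cs → ∀ v → evalAll cs v ≡ F v)

[]ᴾ : IsPRs n 0 (const [])
[]ᴾ = [] , λ _ → refl

infixr 5 _∷ᴾ_
_∷ᴾ_ : ∀ {F} → IsPR n f → IsPRs n m F → IsPRs n (suc m) (λ v → f v ∷ F v)
(c , c-ok) ∷ᴾ (cs , cs-ok) = c ∷ cs , λ v → cong₂ _∷_ (c-ok v) (cs-ok v)

isPR-∘ : ∀ {F} → IsPR m f → IsPRs n m F → IsPR n (f ∘ F)
isPR-∘ (c , c-ok) (cs , cs-ok) = C c cs , λ v → trans (cong (eval c) (cs-ok v)) (c-ok _)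

isPR-resp-≗ : f ≗ g → IsPR n f → IsPR n g
isPR-resp-≗ f≗g (c , c-ok) = c , λ v → trans (c-ok v) (f≗g v)

isPR-zero : IsPR n (const 0)
isPR-zero = Z , λ _ → refl

isPR-lookup : (i : Fin n) → IsPR n (λ v → lookup v i)
isPR-lookup i = P i , λ _ → refl

isPR-head : IsPR (suc n) head
isPR-head = isPR-resp-≗ (λ { (_ ∷ _) → refl }) (isPR-lookup Fin.zero)

isPRs-tabulate : (ρ : Fin m → Fin n) → IsPRs n m (λ v → tabulate (lookup v ∘ ρ))
isPRs-tabulate {zero}  ρ = []ᴾ
isPRs-tabulate {suc m} ρ = isPR-lookup (ρ Fin.zero) ∷ᴾ isPRs-tabulate (ρ ∘ Fin.suc)

isPRs-tail : IsPRs (suc n) n tail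
isPRs-tail with isPRs-tabulate Fin.suc
... | cs , cs-ok = cs , λ { (x ∷ xs) → trans (cs-ok (x ∷ xs)) (tabulate∘lookup xs) }

isPR-recursion : ∀ {g h} (F : ℕ → Vec ℕ n → ℕ) → IsPR n g → IsPR (suc (suc n)) h →
                 (∀ y → F 0 y ≡ g y) → (∀ x y → F (suc x) y ≡ h (F x y ∷ x ∷ y)) →
                 IsPR (suc n) (λ v → F (head v) (tail v))
isPR-recursion {h = h} F (cg , cg-ok) (ch , ch-ok) F-zero F-suc =
  R cg ch , λ { (x ∷ y) → evalRec-correct x y }
  where
  evalRec-correct : ∀ x y → evalRec cg ch x y ≡ F x y
  evalRec-correct zero    y = trans (cg-ok y) (sym (F-zero y))
  evalRec-correct (suc x) y = begin
    eval ch (evalRec cg ch x y ∷ x ∷ y) ≡⟨ cong (λ a → eval ch (a ∷ x ∷ y)) (evalRec-correct x y) ⟩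
    eval ch (F x y ∷ x ∷ y)             ≡⟨ ch-ok _ ⟩
    h (F x y ∷ x ∷ y)                   ≡⟨ F-suc x y ⟨
    F (suc x) y                         ∎
    where open ≡-Reasoning

isPR-∘₁ : ∀ {φ : ℕ → ℕ} → IsPR 1 (φ ∘ head) → IsPR n a → IsPR n (φ ∘ a)
isPR-∘₁ Φ A = isPR-∘ Φ (A ∷ᴾ []ᴾ)

isPR-∘₂ : ∀ {φ : ℕ → ℕ → ℕ} →
          IsPR 2 (λ v → φ (head v) (head (tail v))) → IsPR n a → IsPR n b →
          IsPR n (λ v → φ (a v) (b v))
isPR-∘₂ Φ A B = isPR-∘ Φ (A ∷ᴾ B ∷ᴾ []ᴾ)

isPR-suc : IsPR 1 (suc ∘ head)
isPR-suc = S , λ { (_ ∷ []) → refl }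

isPR-one : IsPR n (const 1)
isPR-one = isPR-∘₁ {φ = suc} isPR-suc isPR-zero

infixl 6 _+ᴾ_ _∸ᴾ_
infixl 7 _*ᴾ_

_+ᴾ_ : IsPR n a → IsPR n b → IsPR n (λ v → a v ℕ.+ b v)
_+ᴾ_ = isPR-∘₂ {φ = ℕ._+_} (isPR-recursion (λ x y → x ℕ.+ head y) isPR-head
  (isPR-∘₁ {φ = suc} isPR-suc isPR-head)
  (λ { (_ ∷ []) → refl }) (λ _ _ → refl))

_*ᴾ_ : IsPR n a → IsPR n b → IsPR n (λ v → a v ℕ.* b v)
_*ᴾ_ = isPR-∘₂ {φ = ℕ._*_} (isPR-recursion (λ x y → x ℕ.* head y) isPR-zero
  (isPR-lookup (Fin.suc (Fin.suc Fin.zero)) +ᴾ isPR-head)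
  (λ _ → refl) (λ { _ (_ ∷ []) → refl }))

_∸ᴾ_ : IsPR n a → IsPR n b → IsPR n (λ v → a v ∸ b v)
A ∸ᴾ B = isPR-∘₂ {φ = flip _∸_}
  (isPR-recursion (λ x y → head y ∸ x) isPR-head (isPR-∘₁ {φ = pred} isPR-pred isPR-head)
    (λ _ → refl) (λ x y → sym (ℕ.pred[m∸n]≡m∸[1+n] (head y) x)))
  B A
  where
  isPR-pred : IsPR 1 (pred ∘ head)
  isPR-pred = isPR-recursion (λ x _ → pred x) isPR-zero
    (isPR-lookup (Fin.suc Fin.zero)) (λ _ → refl) (λ { _ [] → refl })

sg : ℕ → ℕ
sg zero    = 0
sg (suc _) = 1

parity : ℕ → ℕ
parity zero    = 0
parity (suc n) = 1 ∸ parity n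

half : ℕ → ℕ
half zero    = 0
half (suc n) = half n ℕ.+ parity n

sgᴾ : IsPR n a → IsPR n (sg ∘ a)
sgᴾ = isPR-∘₁ {φ = sg}
  (isPR-recursion (λ x _ → sg x) isPR-zero isPR-one (λ _ → refl) (λ { _ [] → refl }))

parityᴾ : IsPR n a → IsPR n (parity ∘ a)
parityᴾ = isPR-∘₁ {φ = parity}
  (isPR-recursion (λ x _ → parity x) isPR-zero (isPR-one ∸ᴾ isPR-head)
    (λ _ → refl) (λ { _ [] → refl }))

halfᴾ : IsPR n a → IsPR n (half ∘ a)
halfᴾ = isPR-∘₁ {φ = half}
  (isPR-recursion (λ x _ → half x) isPR-zero
    (isPR-head +ᴾ parityᴾ (isPR-lookup (Fin.suc Fin.zero)))
    (λ _ → refl) (λ { _ [] → refl }))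

encodeℤ : ℤ → ℕ
encodeℤ z = signBit z ℕ.+ (∣ z ∣ ℕ.+ ∣ z ∣)

parity-double : ∀ m → parity (m ℕ.+ m) ≡ 0
parity-double zero = refl
parity-double (suc m) rewrite ℕ.+-suc m m | parity-double m = refl

half-double : ∀ m → half (m ℕ.+ m) ≡ m
half-double zero = refl
half-double (suc m) rewrite ℕ.+-suc m m | parity-double m | half-double m =
  trans (cong (ℕ._+ 1) (ℕ.+-identityʳ m)) (ℕ.+-comm m 1)

parity-encodeℤ : ∀ z → parity (encodeℤ z) ≡ signBit z
parity-encodeℤ (+ n)    = parity-double n
parity-encodeℤ -[1+ n ] = cong (1 ∸_) (parity-double (suc n))

half-encodeℤ : ∀ z → half (encodeℤ z) ≡ ∣ z ∣
half-encodeℤ (+ n) = half-double n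
half-encodeℤ -[1+ n ] rewrite half-double (suc n) | parity-double (suc n) =
  ℕ.+-identityʳ (suc n)

encodeDiff : ℕ → ℕ → ℕ
encodeDiff a b = sg (b ∸ a) ℕ.+ (d ℕ.+ d)
  where d = (a ∸ b) ℕ.+ (b ∸ a)

encodeℤ-neg : ∀ k → encodeℤ (- + k) ≡ sg k ℕ.+ (k ℕ.+ k)
encodeℤ-neg zero    = refl
encodeℤ-neg (suc k) = refl

encodeℤ-⊖ : ∀ a b → encodeℤ (a ⊖ b) ≡ encodeDiff a b
encodeℤ-⊖ a b with b ≤? a
... | yes b≤a rewrite ⊖-≥ b≤a | ℕ.m≤n⇒m∸n≡0 b≤a | ℕ.+-identityʳ (a ∸ b) = refl
... | no b≰a rewrite ⊖-< (ℕ.≰⇒> b≰a) | ℕ.m≤n⇒m∸n≡0 (ℕ.<⇒≤ (ℕ.≰⇒> b≰a)) =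
  encodeℤ-neg (b ∸ a)

positivePart negativePart : ℕ → ℕ → ℕ
positivePart s m = m ℕ.* (1 ∸ s)
negativePart s m = m ℕ.* s

positivePart⊖negativePart : ∀ z →
  positivePart (signBit z) ∣ z ∣ ⊖ negativePart (signBit z) ∣ z ∣ ≡ z
positivePart⊖negativePart (+ n) rewrite ℕ.*-identityʳ n | ℕ.*-zeroʳ n = refl
positivePart⊖negativePart -[1+ n ] rewrite ℕ.*-identityʳ n | ℕ.*-zeroʳ n = refl

⊖-+-⊖ : ∀ a b c d → (a ⊖ b) + (c ⊖ d) ≡ (a ℕ.+ c) ⊖ (b ℕ.+ d)
⊖-+-⊖ a b c d = begin
  (a ⊖ b) + (c ⊖ d)               ≡⟨ cong₂ _+_ ([+m]-[+n]≡m⊖n a b) ([+m]-[+n]≡m⊖n c d) ⟨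
  (+ a - + b) + (+ c - + d)       ≡⟨ regroup (+ a) (+ b) (+ c) (+ d) ⟩
  (+ a + + c) - (+ b + + d)       ≡⟨ cong₂ _-_ (pos-+ a c) (pos-+ b d) ⟨
  + (a ℕ.+ c) - + (b ℕ.+ d)       ≡⟨ [+m]-[+n]≡m⊖n (a ℕ.+ c) (b ℕ.+ d) ⟩
  (a ℕ.+ c) ⊖ (b ℕ.+ d)           ∎
  where
  open ≡-Reasoning
  regroup : ∀ i j k l → (i - j) + (k - l) ≡ (i + k) - (j + l)
  regroup = solve-∀

addEncoded : ℕ → ℕ → ℕ → ℕ → ℕ
addEncoded s₁ m₁ s₂ m₂ =
  encodeDiff (positivePart s₁ m₁ ℕ.+ positivePart s₂ m₂)
             (negativePart s₁ m₁ ℕ.+ negativePart s₂ m₂)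

encodeℤ-+ : ∀ z w → encodeℤ (z + w) ≡ addEncoded (signBit z) (∣ z ∣) (signBit w) (∣ w ∣)
encodeℤ-+ z w = begin
  encodeℤ (z + w)
    ≡⟨ cong encodeℤ (cong₂ _+_ (positivePart⊖negativePart z) (positivePart⊖negativePart w)) ⟨
  encodeℤ ((pos z ⊖ neg z) + (pos w ⊖ neg w))
    ≡⟨ cong encodeℤ (⊖-+-⊖ (pos z) (neg z) (pos w) (neg w)) ⟩
  encodeℤ ((pos z ℕ.+ pos w) ⊖ (neg z ℕ.+ neg w))
    ≡⟨ encodeℤ-⊖ (pos z ℕ.+ pos w) (neg z ℕ.+ neg w) ⟩
  addEncoded (signBit z) (∣ z ∣) (signBit w) (∣ w ∣) ∎
  where
  open ≡-Reasoning
  pos neg : ℤ → ℕ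
  pos u = positivePart (signBit u) ∣ u ∣
  neg u = negativePart (signBit u) ∣ u ∣

addEncodedᴾ : ∀ {s₁ m₁ s₂ m₂ : Vec ℕ n → ℕ} → IsPR n s₁ → IsPR n m₁ → IsPR n s₂ → IsPR n m₂ →
              IsPR n (λ v → addEncoded (s₁ v) (m₁ v) (s₂ v) (m₂ v))
addEncodedᴾ S₁ M₁ S₂ M₂ = encodeDiffᴾ (positivePartᴾ S₁ M₁ +ᴾ positivePartᴾ S₂ M₂)
                                      (negativePartᴾ S₁ M₁ +ᴾ negativePartᴾ S₂ M₂)
  where
  encodeDiffᴾ : IsPR n a → IsPR n b → IsPR n (λ v → encodeDiff (a v) (b v))
  encodeDiffᴾ A B = sgᴾ (B ∸ᴾ A) +ᴾ (D +ᴾ D)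
    where D = (A ∸ᴾ B) +ᴾ (B ∸ᴾ A)
  positivePartᴾ : IsPR n a → IsPR n b → IsPR n (λ v → positivePart (a v) (b v))
  positivePartᴾ Sg M = M *ᴾ (isPR-one ∸ᴾ Sg)
  negativePartᴾ : IsPR n a → IsPR n b → IsPR n (λ v → negativePart (a v) (b v))
  negativePartᴾ Sg M = M *ᴾ Sg

module _ {p} {g : Vec ℕ p → ℕ} {h : ℤ → ℕ → Vec ℕ p → ℤ} where

  isPR-encodeℤ∘ODE : IsPR p g → IsPRTilde p h →
                     IsPR (suc p) (λ v → encodeℤ (ODE g h (head v) (tail v)))
  isPR-encodeℤ∘ODE G ((cs , cs-ok) , (cm , cm-ok)) =
    isPR-recursion (λ x y → encodeℤ (ODE g h x y)) (isPR-zero +ᴾ (G +ᴾ G))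
      (addEncodedᴾ sign magnitude (evalᴾ cs decoded) (evalᴾ cm decoded))
      (λ _ → refl) ODE-step
    where
    sign : IsPR (suc (suc p)) (parity ∘ head)
    sign = parityᴾ isPR-head
    magnitude : IsPR (suc (suc p)) (half ∘ head)
    magnitude = halfᴾ isPR-head
    decoded : IsPRs (suc (suc p)) (suc (suc (suc p))) (λ v → parity (head v) ∷ half (head v) ∷ tail v)
    decoded = sign ∷ᴾ magnitude ∷ᴾ isPRs-tail
    evalᴾ : ∀ {F} (c : PR (suc (suc (suc p)))) →
            IsPRs (suc (suc p)) (suc (suc (suc p))) F → IsPR (suc (suc p)) (eval c ∘ F)
    evalᴾ c = isPR-∘ (c , λ _ → refl)

    ODE-step : ∀ x y → let e = encodeℤ (ODE g h x y) ; d = parity e ∷ half e ∷ x ∷ y in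
               encodeℤ (ODE g h (suc x) y) ≡ addEncoded (parity e) (half e) (eval cs d) (eval cm d)
    ODE-step x y
      rewrite parity-encodeℤ (ODE g h x y) | half-encodeℤ (ODE g h x y)
            | cs-ok (ODE g h x y) x y | cm-ok (ODE g h x y) x y
      = encodeℤ-+ (ODE g h x y) (h (ODE g h x y) x y)

  isPR-signBit∘ODE : IsPR p g → IsPRTilde p h →
                     IsPR (suc p) (λ v → signBit (ODE g h (head v) (tail v)))
  isPR-signBit∘ODE G H = isPR-resp-≗ (λ { (x ∷ y) → parity-encodeℤ (ODE g h x y) })
                                     (parityᴾ (isPR-encodeℤ∘ODE G H))

  isPR-∣∣∘ODE : IsPR p g → IsPRTilde p h →
                IsPR (suc p) (λ v → ∣ ODE g h (head v) (tail v) ∣)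
  isPR-∣∣∘ODE G H = isPR-resp-≗ (λ { (x ∷ y) → half-encodeℤ (ODE g h x y) })
                                (halfᴾ (isPR-encodeℤ∘ODE G H))

REC≡ODE : ∀ {p} (g : Vec ℕ p → ℕ) (h : ℕ → ℕ → Vec ℕ p → ℕ) x y →
          + REC g h x y ≡ ODE g (λ z x y → + h ∣ z ∣ x y - z) x y
REC≡ODE g h zero    y = refl
REC≡ODE g h (suc x) y = begin
  + h r x y                        ≡⟨ telescope (+ r) (+ h r x y) ⟨
  + r + (+ h r x y - + r)          ≡⟨ cong (λ z → z + (+ h ∣ z ∣ x y - z)) (REC≡ODE g h x y) ⟩
  ODE g h̄ x y + h̄ (ODE g h̄ x y) x y ∎
  where
  open ≡-Reasoning
  r : ℕ
  r = REC g h x y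
  h̄ : ℤ → ℕ → Vec ℕ _ → ℤ
  h̄ z x y = + h ∣ z ∣ x y - z
  telescope : ∀ i j → i + (j - i) ≡ j
  telescope = solve-∀

mainTheorem10 :
  -- (1)
  (∀ (p : ℕ) (g : Vec ℕ p → ℕ) (h : ℤ → ℕ → Vec ℕ p → ℤ) →
    IsPR p g →
    -- h̃ is primitive recursive
    IsPRTilde p h →
    -- f̃ is primitive recursive
    (IsPR (suc p) (λ v → signBit (ODE g h (head v) (tail v)))
      × IsPR (suc p) (λ v → ∣ ODE g h (head v) (tail v) ∣))
    × ((∀ x y → 0ℤ ≤ ODE g h x y) →
        IsPR (suc p) (λ v → ∣ ODE g h (head v) (tail v) ∣)))
  ×
  -- (2)
  (∀ (p : ℕ) (g : Vec ℕ p → ℕ) (h : ℕ → ℕ → Vec ℕ p → ℕ) →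
    ∀ x y → + REC g h x y ≡ ODE g (λ z x y → + h ∣ z ∣ x y - z) x y)
-- A nonnegative f coincides with its magnitude, so the last clause needs no extra argument.
mainTheorem10 =
  (λ p g h G H → (isPR-signBit∘ODE G H , isPR-∣∣∘ODE G H) , λ _ → isPR-∣∣∘ODE G H) ,
  (λ p → REC≡ODE)
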